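{- Let $T$ be a tree whose edges are presented as a stream $S=(e_1,\dots,e_m)$ in any order, let $M^*$ be the size of a maximum matching of $T$, and let $E_1$ be the set of $1$-good edges of $S$. Then $M^*\le|E_1|\le 2M^*$.
   Context: For a stream $S=(e_1,\dots,e_m)$ of edges and a vertex $x$, let $d_i(x)$ be the number of edges incident to $x$ among $e_{i+1},\dots,e_m$. The edge $e_i=(u,v)$ is $1$-good with respect to $S$ if $\max\{d_i(u),d_i(v)\}\le 1$. -}

module Defs where

open import Data.Nat using (ℕ; zero; suc; _≤_; _<_; _≤?_)
open import Data.Fin using (Fin; toℕ; _≟_)
open import Data.List using (List; []; _∷_; length; filter; drop; lookup; allFin)
open import Data.List.Membership.Propositional using (_∈_)
open import Data.List.Relation.Unary.All using (All)
open import Data.List.Relation.Unary.AllPairs using (AllPairs)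
open import Data.List.Relation.Unary.Unique.Propositional using (Unique)
open import Data.Product using (_×_; _,_; proj₁; proj₂; Σ)
open import Data.Sum using (_⊎_)
open import Relation.Nullary using (¬_; Dec)
open import Relation.Nullary.Decidable using (_⊎-dec_; _×-dec_)
open import Relation.Binary.PropositionalEquality using (_≡_; _≢_)
open import Relation.Binary.Construct.Closure.ReflexiveTransitive using (Star)

-- An edge on the vertex set Fin n (an unordered pair, stored as an ordered pair).
Edge : ℕ → Set
Edge n = Fin n × Fin n

Stream : ℕ → Set
Stream n = List (Edge n)

SameEdge : ∀ {n} → Edge n → Edge n → Set
SameEdge (u , v) (u' , v') = (u ≡ u' × v ≡ v') ⊎ (u ≡ v' × v ≡ u')

Simple : ∀ {n} → Stream n → Set
Simple S = All (λ e → proj₁ e ≢ proj₂ e) S × AllPairs (λ e f → ¬ SameEdge e f) S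

Adj : ∀ {n} → Stream n → Fin n → Fin n → Set
Adj S u v = (u , v) ∈ S ⊎ (v , u) ∈ S

Connected : ∀ {n} → Stream n → Set
Connected {n} S = (u v : Fin n) → Star (Adj S) u v

data Path {n} (S : Stream n) : List (Fin n) → Set where
  single : ∀ v → Path S (v ∷ [])
  step   : ∀ {u v vs} → Adj S u v → Path S (v ∷ vs) → Path S (u ∷ v ∷ vs)

data Last {A : Set} : List A → A → Set where
  last-one  : ∀ x → Last (x ∷ []) x
  last-cons : ∀ {x y xs} → Last xs y → Last (x ∷ xs) y

record Cycle {n} (S : Stream n) : Set where
  field
    first : Fin n
    rest  : List (Fin n)
    final : Fin n
    long  : 3 ≤ length (first ∷ rest)
    path  : Path S (first ∷ rest)
    isLast : Last (first ∷ rest) final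
    distinct : Unique (first ∷ rest)
    closes : Adj S final first

Acyclic : ∀ {n} → Stream n → Set
Acyclic S = ¬ Cycle S

IsTree : (n : ℕ) → Stream n → Set
IsTree n S = 0 < n × Simple S × Connected S × Acyclic S

Incident : ∀ {n} → Fin n → Edge n → Set
Incident x (u , v) = x ≡ u ⊎ x ≡ v

incident? : ∀ {n} (x : Fin n) (e : Edge n) → Dec (Incident x e)
incident? x (u , v) = (x ≟ u) ⊎-dec (x ≟ v)

-- d_i(x): number of edges among e_{i+1}, …, e_m incident to x
-- (positions i : Fin m are 0-based, so e_{i+1},… is drop (suc i) S).
d : ∀ {n} (S : Stream n) → Fin (length S) → Fin n → ℕ
d S i x = length (filter (incident? x) (drop (suc (toℕ i)) S))

OneGood : ∀ {n} (S : Stream n) → Fin (length S) → Set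
OneGood S i = d S i (proj₁ (lookup S i)) ≤ 1 × d S i (proj₂ (lookup S i)) ≤ 1

oneGood? : ∀ {n} (S : Stream n) (i : Fin (length S)) → Dec (OneGood S i)
oneGood? S i = (d S i (proj₁ (lookup S i)) ≤? 1) ×-dec (d S i (proj₂ (lookup S i)) ≤? 1)

numOneGood : ∀ {n} → Stream n → ℕ
numOneGood S = length (filter (oneGood? S) (allFin (length S)))

Disjoint : ∀ {n} → Edge n → Edge n → Set
Disjoint (u , v) (u' , v') = u ≢ u' × u ≢ v' × v ≢ u' × v ≢ v'

IsMatching : ∀ {n} → Stream n → List (Edge n) → Set
IsMatching S M = All (_∈ S) M × AllPairs Disjoint M

IsMaxMatchingSize : ∀ {n} → Stream n → ℕ → Set
IsMaxMatchingSize S k =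
  Σ (List _) (λ M → IsMatching S M × length M ≡ k)
  × (∀ M → IsMatching S M → length M ≤ k)

-- The 1-good edges form a forest of maximum degree 2: the first 1-good edge at a vertex leaves at
-- most one later edge there. Repeatedly matching a leaf edge and deleting the edges at the leaf's
-- neighbour gives a matching of at least half of them, so |E₁| ≤ 2M*.
--
-- For the lower bound, read the stream backwards and follow Φ = Σₓ min(deg x, 2) over the suffix:
-- prepending an edge raises Φ by at most 2, and by at most 1 unless the edge is 1-good, so
-- Φ ≤ m + |E₁|. In a tree with m ≥ 1 edges, Φ = (m + 1) + #{x : deg x ≥ 2}. A matching edge
-- without an endpoint of degree ≥ 2 is the whole tree, so the other matching edges have distinct
-- such endpoints and M* ≤ 1 + #{x : deg x ≥ 2} ≤ |E₁|.
module Submission where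

open import Data.Bool using (true; false; if_then_else_)
open import Data.Empty using (⊥-elim)
open import Data.Fin using (Fin; zero; suc; _≟_; toℕ)
import Data.Fin as Fin
open import Data.List using (List; []; _∷_; length; filter; take; map; tabulate; allFin)
open import Data.List.Membership.Propositional using (_∈_)
open import Data.List.Membership.Propositional.Properties using (∈-filter⁺; ∈-filter⁻)
open import Data.List.Properties using (filter-some; filter-none; length-map; map-tabulate)
open import Data.List.Relation.Binary.Sublist.Propositional using ([]; _∷_; _∷ʳ_) renaming (_⊆_ to _⊑_)
import Data.List.Relation.Binary.Sublist.Propositional.Properties as Sublist
open import Data.List.Relation.Unary.All using (All; []; _∷_)
import Data.List.Relation.Unary.All as All
open import Data.List.Relation.Unary.All.Properties using (all-filter; ¬Any⇒All¬)
open import Data.List.Relation.Unary.AllPairs using (AllPairs; []; _∷_)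
import Data.List.Relation.Unary.AllPairs.Properties as AllPairs
open import Data.List.Relation.Unary.Any using (Any; here; there; any?)
import Data.List.Relation.Unary.Any as Any
open import Data.List.Relation.Unary.Unique.Propositional using (Unique)
open import Data.List.Relation.Unary.Unique.Propositional.Properties using (Unique[x∷xs]⇒x∉xs; take⁺)
open import Data.Nat using (ℕ; zero; suc; _+_; _*_; _⊓_; _≤_; _<_; z≤n; s≤s)
open import Data.Nat.Induction using (<-wellFounded)
open import Data.Nat.Properties hiding (_≟_)
open import Data.Nat.Tactic.RingSolver using (solve-∀)
open import Data.Product using (_×_; _,_; proj₁; proj₂; map₂; ∃-syntax)
open import Data.Sum using (_⊎_; inj₁; inj₂)
import Data.Sum as ⊎
open import Function using (_∘′_; id)
open import Induction.WellFounded using (Acc; acc)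
open import Level using (Level)
open import Relation.Binary.Construct.Closure.ReflexiveTransitive using (Star; ε; _◅_)
open import Relation.Binary.PropositionalEquality
open import Relation.Nullary using (¬_; Dec; yes; no; does; contradiction)
open import Relation.Nullary.Decidable using (_⊎-dec_; _×-dec_)
open import Relation.Unary using (Pred; Decidable; _⊆_)
open import Relation.Unary.Properties using (U?; ∁?)

open import Defs
open import Algebra.Properties.CommutativeMonoid.Sum +-0-commutativeMonoid
  using (sum; sum-syntax; ∑-distrib-+; sum-cong-≗; sum-replicate-zero)

private
  variable
    n : ℕ
    A B : Set
    a b v w x y : Fin n
    e f : Edge n
    H S : Stream n
    vs ws : List (Fin n)
    p q : Level
    P : Set p
    Q : Set q

𝟙 : Dec P → ℕ
𝟙 d = if does d then 1 else 0

𝟙≤1 : (d : Dec P) → 𝟙 d ≤ 1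
𝟙≤1 (yes _) = ≤-refl
𝟙≤1 (no _)  = z≤n

𝟙-mono : (P → Q) → (d : Dec P) (d′ : Dec Q) → 𝟙 d ≤ 𝟙 d′
𝟙-mono f (yes _)  (yes _)  = ≤-refl
𝟙-mono f (yes p′) (no ¬q′) = contradiction (f p′) ¬q′
𝟙-mono f (no _)   _        = z≤n

𝟙-⊎-≤ : (d : Dec P) (d′ : Dec Q) → 𝟙 (d ⊎-dec d′) ≤ 𝟙 d + 𝟙 d′
𝟙-⊎-≤ (yes _) _       = s≤s z≤n
𝟙-⊎-≤ (no _)  (yes _) = ≤-refl
𝟙-⊎-≤ (no _)  (no _)  = z≤n

𝟙+𝟙≤1+𝟙-× : (d : Dec P) (d′ : Dec Q) → 𝟙 d + 𝟙 d′ ≤ 1 + 𝟙 (d ×-dec d′)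
𝟙+𝟙≤1+𝟙-× (yes _) (yes _) = ≤-refl
𝟙+𝟙≤1+𝟙-× (yes _) (no _)  = ≤-refl
𝟙+𝟙≤1+𝟙-× (no _)  (yes _) = ≤-refl
𝟙+𝟙≤1+𝟙-× (no _)  (no _)  = z≤n

∑-mono-≤ : {f g : Fin n → ℕ} → (∀ x → f x ≤ g x) → sum f ≤ sum g
∑-mono-≤ {zero}  f≤g = z≤n
∑-mono-≤ {suc n} {f} {g} f≤g = +-mono-≤ (f≤g zero) (∑-mono-≤ (λ x → f≤g (suc x)))

∑-sift : (u : Fin n) (f : Fin n → ℕ) → ∑[ x < n ] (𝟙 (x ≟ u) * f x) ≡ f u
∑-sift {suc n} zero    f = trans (cong₂ _+_ (+-identityʳ (f zero)) (sum-replicate-zero n)) (+-identityʳ (f zero))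
∑-sift {suc n} (suc u) f = ∑-sift u (λ x → f (suc x))

count : {P : Pred (Fin n) p} → Decidable P → ℕ
count {n} P? = ∑[ x < n ] 𝟙 (P? x)

module _ {P : Pred (Fin n) p} {Q : Pred (Fin n) q} (P? : Decidable P) (Q? : Decidable Q) where

  count-mono : P ⊆ Q → count P? ≤ count Q?
  count-mono P⊆Q = ∑-mono-≤ (λ x → 𝟙-mono P⊆Q (P? x) (Q? x))

  count-insert : ∀ {u} → P ⊆ Q → Q u → ¬ P u → count P? < count Q?
  count-insert {u} P⊆Q Qu ¬Pu = begin
    suc (count P?)                        ≡⟨ +-comm 1 (count P?) ⟩
    count P? + 1                          ≡⟨ cong (count P? +_) (sym count-≟) ⟩
    count P? + count (_≟ u)               ≡⟨ sym (∑-distrib-+ (λ x → 𝟙 (P? x)) (λ x → 𝟙 (x ≟ u))) ⟩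
    ∑[ x < n ] (𝟙 (P? x) + 𝟙 (x ≟ u))     ≤⟨ ∑-mono-≤ pointwise ⟩
    count Q?                              ∎
    where
    open ≤-Reasoning
    count-≟ : count (_≟ u) ≡ 1
    count-≟ = trans (sum-cong-≗ {x = λ x → 𝟙 (x ≟ u)} (λ x → sym (*-identityʳ _))) (∑-sift u (λ _ → 1))
    pointwise : ∀ x → 𝟙 (P? x) + 𝟙 (x ≟ u) ≤ 𝟙 (Q? x)
    pointwise x with x ≟ u | P? x | Q? x
    ... | yes refl | yes Pu | _      = contradiction Pu ¬Pu
    ... | yes refl | no _   | yes _  = ≤-refl
    ... | yes refl | no _   | no ¬Qu = contradiction Qu ¬Qu
    ... | no _     | d      | d′     = subst (_≤ 𝟙 d′) (sym (+-identityʳ (𝟙 d))) (𝟙-mono P⊆Q d d′)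

length≤count∈ : {xs : List (Fin n)} → Unique xs → length xs ≤ count (λ x → any? (x ≟_) xs)
length≤count∈ []            = z≤n
length≤count∈ {xs = y ∷ ys} uniq@(_ ∷ uniq′) =
  ≤-trans (s≤s (length≤count∈ uniq′)) (count-insert (λ x → any? (x ≟_) ys) (λ x → any? (x ≟_) (y ∷ ys))
                                         there (here refl) (Unique[x∷xs]⇒x∉xs uniq))

length≤count : {P : Pred (Fin n) p} (P? : Decidable P) {xs : List (Fin n)} →
               Unique xs → All P xs → length xs ≤ count P?
length≤count P? {xs} uniq all =
  ≤-trans (length≤count∈ uniq) (count-mono (λ x → any? (x ≟_) xs) P? (All.lookup all))

count-U : count {n} U? ≡ n
count-U {zero}  = refl
count-U {suc n} = cong suc (count-U {n})

length≤n : {xs : List (Fin n)} → Unique xs → length xs ≤ n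
length≤n {xs = xs} uniq = subst (length xs ≤_) count-U (length≤count U? uniq (All.universal _ xs))

length-filter+length-filter-∁ : {P : Pred A p} (P? : Decidable P) (xs : List A) →
                                length (filter P? xs) + length (filter (∁? P?) xs) ≡ length xs
length-filter+length-filter-∁ P? []       = refl
length-filter+length-filter-∁ P? (x ∷ xs) with does (P? x)
... | true  = cong suc (length-filter+length-filter-∁ P? xs)
... | false = trans (+-suc _ _) (cong suc (length-filter+length-filter-∁ P? xs))

length-filter-∷ : {P : Pred A p} (P? : Decidable P) (x : A) (xs : List A) →
                  length (filter P? (x ∷ xs)) ≡ 𝟙 (P? x) + length (filter P? xs)
length-filter-∷ P? x xs with does (P? x)
... | true  = refl
... | false = refl

filter-map : {P : Pred A p} (P? : Decidable P) (f : B → A) (xs : List B) →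
             filter P? (map f xs) ≡ map f (filter (λ x → P? (f x)) xs)
filter-map P? f []       = refl
filter-map P? f (x ∷ xs) with does (P? (f x))
... | true  = cong (f x ∷_) (filter-map P? f xs)
... | false = filter-map P? f xs

AllPairs-⊑ : {R : A → A → Set p} {xs ys : List A} → xs ⊑ ys → AllPairs R ys → AllPairs R xs
AllPairs-⊑ []         []         = []
AllPairs-⊑ (_ ∷ʳ σ)   (_ ∷ rys)  = AllPairs-⊑ σ rys
AllPairs-⊑ (refl ∷ σ) (ry ∷ rys) = Sublist.All-resp-⊆ σ ry ∷ AllPairs-⊑ σ rys

degree : Stream n → Fin n → ℕ
degree H x = length (filter (incident? x) H)

degree-∷ : (e : Edge n) (H : Stream n) (x : Fin n) → degree (e ∷ H) x ≡ 𝟙 (incident? x e) + degree H x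
degree-∷ e H x = length-filter-∷ (incident? x) e H

degree-⊑ : H ⊑ S → ∀ x → degree H x ≤ degree S x
degree-⊑ σ x = Sublist.length-mono-≤ (Sublist.filter⁺ (incident? x) (incident? x) (λ { refl i → i }) σ)

incident⇒degree>0 : e ∈ H → Incident x e → 0 < degree H x
incident⇒degree>0 {x = x} e∈H x∈e = filter-some (incident? x) (Any.map (λ { refl → x∈e }) e∈H)

degree≤1⇒unique : degree H x ≤ 1 → e ∈ H → f ∈ H → Incident x e → Incident x f → e ≡ f
degree≤1⇒unique {x = x} d≤1 e∈H f∈H x∈e x∈f =
  singleton d≤1 (∈-filter⁺ (incident? x) e∈H x∈e) (∈-filter⁺ (incident? x) f∈H x∈f)
  where
  singleton : ∀ {xs : List A} {a b} → length xs ≤ 1 → a ∈ xs → b ∈ xs → a ≡ b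
  singleton {xs = _ ∷ []}    _        (here refl) (here refl) = refl
  singleton {xs = _ ∷ []}    _        (there ())  _
  singleton {xs = _ ∷ []}    _        _           (there ())
  singleton {xs = _ ∷ _ ∷ _} (s≤s ()) _           _

_∖_ : Stream n → Fin n → Stream n
H ∖ x = filter (∁? (incident? x)) H

∖-⊑ : (H : Stream n) (x : Fin n) → H ∖ x ⊑ H
∖-⊑ H x = Sublist.filter-⊆ (∁? (incident? x)) H

length-∖ : (H : Stream n) (x : Fin n) → length H ≡ degree H x + length (H ∖ x)
length-∖ H x = sym (length-filter+length-filter-∁ (incident? x) H)

degree-∖-self : (H : Stream n) (x : Fin n) → degree (H ∖ x) x ≡ 0
degree-∖-self H x = cong length (filter-none (incident? x) (all-filter (∁? (incident? x)) H))

length-∖-< : 0 < degree H x → length (H ∖ x) < length H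
length-∖-< {H = H} {x} d>0 = subst (length (H ∖ x) <_) (sym (length-∖ H x)) (+-monoˡ-≤ (length (H ∖ x)) d>0)

-- Forests and their leaves

Adj-sym : Adj H x y → Adj H y x
Adj-sym = ⊎.swap

Adj-⊑ : H ⊑ S → Adj H x y → Adj S x y
Adj-⊑ σ = ⊎.map (Sublist.Any-resp-⊆ σ) (Sublist.Any-resp-⊆ σ)

adjacent-edge : Adj H x y → ∃[ e ] e ∈ H × SameEdge e (x , y)
adjacent-edge (inj₁ e∈H) = _ , e∈H , inj₁ (refl , refl)
adjacent-edge (inj₂ e∈H) = _ , e∈H , inj₂ (refl , refl)

SameEdge⇒incident : SameEdge e (x , y) → Incident x e × Incident y e
SameEdge⇒incident (inj₁ (refl , refl)) = inj₁ refl , inj₂ refl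
SameEdge⇒incident (inj₂ (refl , refl)) = inj₂ refl , inj₁ refl

SameEdge-trans-sym : SameEdge e (x , y) → SameEdge f (x , y) → SameEdge e f
SameEdge-trans-sym (inj₁ (refl , refl)) (inj₁ (refl , refl)) = inj₁ (refl , refl)
SameEdge-trans-sym (inj₁ (refl , refl)) (inj₂ (refl , refl)) = inj₂ (refl , refl)
SameEdge-trans-sym (inj₂ (refl , refl)) (inj₁ (refl , refl)) = inj₂ (refl , refl)
SameEdge-trans-sym (inj₂ (refl , refl)) (inj₂ (refl , refl)) = inj₁ (refl , refl)

Adj⇒degree>0 : Adj H x y → 0 < degree H x
Adj⇒degree>0 x~y with _ , e∈H , e≈xy ← adjacent-edge x~y =
  incident⇒degree>0 e∈H (proj₁ (SameEdge⇒incident e≈xy))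

Adj⇒≢ : Simple H → Adj H x y → x ≢ y
Adj⇒≢ (loopless , _) (inj₁ xy∈H) = All.lookup loopless xy∈H
Adj⇒≢ (loopless , _) (inj₂ yx∈H) = ≢-sym (All.lookup loopless yx∈H)

Path-⊑ : H ⊑ S → Path H vs → Path S vs
Path-⊑ σ (single v)      = single v
Path-⊑ σ (step x~y path) = step (Adj-⊑ σ x~y) (Path-⊑ σ path)

Path-take : ∀ k → Path H vs → Path H (take (suc k) vs)
Path-take zero    (single v)      = single v
Path-take (suc k) (single v)      = single v
Path-take zero    (step _ _)      = single _
Path-take (suc k) (step x~y path) = step x~y (Path-take k path)

Last-take-index : (y∈ : y ∈ vs) → Last (take (suc (toℕ (Any.index y∈))) vs) y
Last-take-index (here refl) = last-one _
Last-take-index (there y∈)  = last-cons (Last-take-index y∈)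

Acyclic-⊑ : H ⊑ S → Acyclic S → Acyclic H
Acyclic-⊑ σ acyclic c = acyclic (record
  { first = first ; rest = rest ; final = final ; long = long ; path = Path-⊑ σ path
  ; isLast = isLast ; distinct = distinct ; closes = Adj-⊑ σ closes })
  where open Cycle c

Forest : Stream n → Set
Forest H = Simple H × Acyclic H

Forest-⊑ : H ⊑ S → Forest S → Forest H
Forest-⊑ σ ((loopless , distinct) , acyclic) =
  (Sublist.All-resp-⊆ σ loopless , AllPairs-⊑ σ distinct) , Acyclic-⊑ σ acyclic

-- The cycle v, w, …, y: the path cut off just after y.
closeCycle : Path H (v ∷ w ∷ ws) → Unique (v ∷ w ∷ ws) → y ∈ ws → Adj H y v → Cycle H
closeCycle {v = v} {w} {ws = r ∷ rs} {y} path uniq y∈ y~v = record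
  { first = v ; rest = w ∷ take (suc i) (r ∷ rs) ; final = y
  ; long = s≤s (s≤s (s≤s z≤n)) ; path = Path-take (suc (suc i)) path
  ; isLast = last-cons (last-cons (Last-take-index y∈)) ; distinct = take⁺ (3 + i) uniq ; closes = y~v }
  where i = toℕ (Any.index y∈)

neighbourVia : e ∈ H → Incident x e → (w : Fin n) → SameEdge e (x , w) ⊎ ∃[ y ] Adj H x y × y ≢ w
neighbourVia {e = a , b} e∈H (inj₁ refl) w with b ≟ w
... | yes b≡w = inj₁ (inj₁ (refl , b≡w))
... | no  b≢w = inj₂ (b , inj₁ e∈H , b≢w)
neighbourVia {e = a , b} e∈H (inj₂ refl) w with a ≟ w
... | yes a≡w = inj₁ (inj₂ (a≡w , refl))
... | no  a≢w = inj₂ (a , inj₂ e∈H , a≢w)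

anotherNeighbour : Simple H → 2 ≤ degree H x → (w : Fin n) → ∃[ y ] Adj H x y × y ≢ w
anotherNeighbour {n = n} {H = H} {x} (_ , distinct) d≥2 w =
  pick (filter (incident? x) H) d≥2 (∈-filter⁻ (incident? x) {xs = H}) (AllPairs.filter⁺ (incident? x) distinct)
  where
  pick : (E : Stream n) → 2 ≤ length E → (∀ {d} → d ∈ E → d ∈ H × Incident x d) →
         AllPairs (λ d d′ → ¬ SameEdge d d′) E → ∃[ y ] Adj H x y × y ≢ w
  pick (e₁ ∷ e₂ ∷ _) _ mem ((e₁≉e₂ ∷ _) ∷ _)
    with neighbourVia (proj₁ (mem (here refl))) (proj₂ (mem (here refl))) w
       | neighbourVia (proj₁ (mem (there (here refl)))) (proj₂ (mem (there (here refl)))) w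
  ... | inj₂ found | _          = found
  ... | inj₁ _     | inj₂ found = found
  ... | inj₁ e₁≈xw | inj₁ e₂≈xw = contradiction (SameEdge-trans-sym e₁≈xw e₂≈xw) e₁≉e₂
  pick (_ ∷ []) (s≤s ()) _ _

record Leaf (H : Stream n) : Set where
  field
    leaf neighbour : Fin n
    adjacent       : Adj H leaf neighbour
    degree≡1       : degree H leaf ≡ 1

module _ {H : Stream n} (forest : Forest H) where

  private
    simple  = proj₁ forest
    acyclic = proj₂ forest

  -- Extend the simple path v, w, … at its head by a neighbour of v other than w: that neighbour
  -- is not on the path, as it would close a cycle, so after at most n steps v has degree 1.
  walkToLeaf : ∀ k → Path H (v ∷ w ∷ ws) → Unique (v ∷ w ∷ ws) → n ≤ k + length ws → Leaf H
  walkToLeaf zero _ uniq n≤ = ⊥-elim (1+n≰n (≤-trans (n≤1+n _) (≤-trans (length≤n uniq) n≤)))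
  walkToLeaf {v = v} {w} {ws} (suc k) path@(step v~w _) uniq n≤ with 2 ≤? degree H v
  ... | no  d≱2 = record
    { leaf = v ; neighbour = w ; adjacent = v~w
    ; degree≡1 = ≤-antisym (≤-pred (≰⇒> d≱2)) (Adj⇒degree>0 v~w) }
  ... | yes d≥2 with y , v~y , y≢w ← anotherNeighbour simple d≥2 w with any? (y ≟_) ws
  ...   | yes y∈ws = ⊥-elim (acyclic (closeCycle path uniq y∈ws (Adj-sym v~y)))
  ...   | no  y∉ws = walkToLeaf k (step (Adj-sym v~y) path) (fresh ∷ uniq) (subst (n ≤_) (sym (+-suc k _)) n≤)
    where
    fresh : All (y ≢_) (v ∷ w ∷ ws)
    fresh = ≢-sym (Adj⇒≢ simple v~y) ∷ y≢w ∷ ¬Any⇒All¬ ws y∉ws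

  leafOf : e ∈ H → Leaf H
  leafOf {e = a , b} ab∈H = walkToLeaf n (step (inj₂ ab∈H) (single a)) ((b≢a ∷ []) ∷ [] ∷ []) (m≤m+n n 0)
    where
    b≢a : b ≢ a
    b≢a = ≢-sym (Adj⇒≢ simple (inj₁ ab∈H))

nonisolated internal : Stream n → ℕ
nonisolated H = count (λ x → 1 ≤? degree H x)
internal    H = count (λ x → 2 ≤? degree H x)

module _ {H : Stream n} (L : Leaf H) where
  open Leaf L

  length-∖-leaf : length H ≡ suc (length (H ∖ leaf))
  length-∖-leaf = trans (length-∖ H leaf) (cong (_+ length (H ∖ leaf)) degree≡1)

  nonisolated-∖-leaf : nonisolated (H ∖ leaf) < nonisolated H
  nonisolated-∖-leaf = count-insert (λ x → 1 ≤? degree (H ∖ leaf) x) (λ x → 1 ≤? degree H x)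
    (λ {x} d>0 → ≤-trans d>0 (degree-⊑ (∖-⊑ H leaf) x))
    (Adj⇒degree>0 adjacent) (<-irrefl (sym (degree-∖-self H leaf)))

  2≤nonisolated : Simple H → 2 ≤ nonisolated H
  2≤nonisolated simple = length≤count (λ x → 1 ≤? degree H x) ((leaf≢neighbour ∷ []) ∷ [] ∷ [])
    (Adj⇒degree>0 adjacent ∷ Adj⇒degree>0 (Adj-sym adjacent) ∷ [])
    where leaf≢neighbour = Adj⇒≢ simple adjacent

length<nonisolated : Forest H → e ∈ H → length H < nonisolated H
length<nonisolated {H = H} = go H (<-wellFounded (length H))
  where
  go : ∀ H → Acc _<_ (length H) → Forest H → e ∈ H → length H < nonisolated H
  go H (acc rec) forest e∈H with L ← leafOf forest e∈H
    with H ∖ Leaf.leaf L | length-∖-leaf L | nonisolated-∖-leaf L | Forest-⊑ (∖-⊑ H (Leaf.leaf L)) forest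
  ... | []     | len≡ | _   | _       = subst (_< nonisolated H) (sym len≡) (2≤nonisolated L (proj₁ forest))
  ... | f ∷ H′ | len≡ | ni< | forest′ = begin-strict
    length H                   ≡⟨ len≡ ⟩
    suc (length (f ∷ H′))      <⟨ s≤s (go (f ∷ H′) (rec (≤-reflexive (sym len≡))) forest′ (here refl)) ⟩
    suc (nonisolated (f ∷ H′)) ≤⟨ ni< ⟩
    nonisolated H              ∎
    where open ≤-Reasoning

Disjoint-avoiding : SameEdge e (x , y) → ¬ Incident x f → ¬ Incident y f → Disjoint e f
Disjoint-avoiding (inj₁ (refl , refl)) x∉f y∉f = x∉f ∘′ inj₁ , x∉f ∘′ inj₂ , y∉f ∘′ inj₁ , y∉f ∘′ inj₂
Disjoint-avoiding (inj₂ (refl , refl)) x∉f y∉f = y∉f ∘′ inj₁ , y∉f ∘′ inj₂ , x∉f ∘′ inj₁ , x∉f ∘′ inj₂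

IsMatching-⊑ : {M : List (Edge n)} → H ⊑ S → IsMatching H M → IsMatching S M
IsMatching-⊑ σ (M⊆H , disjoint) = All.map (Sublist.Any-resp-⊆ σ) M⊆H , disjoint

Disjoint⇒¬incident : Disjoint e f → Incident x e → ¬ Incident x f
Disjoint⇒¬incident (a≢c , _ , _ , _) (inj₁ refl) (inj₁ refl) = a≢c refl
Disjoint⇒¬incident (_ , a≢d , _ , _) (inj₁ refl) (inj₂ refl) = a≢d refl
Disjoint⇒¬incident (_ , _ , b≢c , _) (inj₂ refl) (inj₁ refl) = b≢c refl
Disjoint⇒¬incident (_ , _ , _ , b≢d) (inj₂ refl) (inj₂ refl) = b≢d refl

-- The leaf lies on no edge but e, and e meets the neighbour.
leafEdge-disjoint : (L : Leaf H) → let open Leaf L in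
                    e ∈ H → SameEdge e (leaf , neighbour) → f ∈ H ∖ neighbour → Disjoint e f
leafEdge-disjoint L e∈H e≈ f∈H′
  with f∈H , neighbour∉f ← ∈-filter⁻ (∁? (incident? (Leaf.neighbour L))) f∈H′ =
  Disjoint-avoiding e≈ leaf∉f neighbour∉f
  where
  open Leaf L
  leaf∉f : ¬ Incident leaf _
  leaf∉f leaf∈f = neighbour∉f (subst (Incident neighbour)
    (degree≤1⇒unique (≤-reflexive degree≡1) e∈H f∈H (proj₁ (SameEdge⇒incident e≈)) leaf∈f)
    (proj₂ (SameEdge⇒incident e≈)))

-- The neighbour of the leaf has degree at most 2, so at most two edges are lost per matched edge.
halfMatching : Forest H → (∀ x → degree H x ≤ 2) → ∃[ M ] IsMatching H M × length H ≤ 2 * length M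
halfMatching {H = H} = go H (<-wellFounded (length H))
  where
  go : ∀ H → Acc _<_ (length H) → Forest H → (∀ x → degree H x ≤ 2) →
       ∃[ M ] IsMatching H M × length H ≤ 2 * length M
  go []        _         _      _    = [] , ([] , []) , z≤n
  go H@(_ ∷ _) (acc rec) forest d≤2 =
    let e , e∈H , e≈ = adjacent-edge adjacent
        M , (M⊆H′ , disjoint) , length≤ = go (H ∖ neighbour) (rec (length-∖-< {H = H} {neighbour} neighbour>0))
                                            (Forest-⊑ H′⊑H forest) (λ x → ≤-trans (degree-⊑ H′⊑H x) (d≤2 x))
    in e ∷ M
     , ( e∈H ∷ All.map (Sublist.Any-resp-⊆ H′⊑H) M⊆H′
       , All.map (leafEdge-disjoint L e∈H e≈) M⊆H′ ∷ disjoint )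
     , (begin
       length H                                    ≡⟨ length-∖ H neighbour ⟩
       degree H neighbour + length (H ∖ neighbour) ≤⟨ +-mono-≤ (d≤2 neighbour) length≤ ⟩
       2 + 2 * length M                            ≡⟨ sym (*-suc 2 (length M)) ⟩
       2 * suc (length M)                          ∎)
    where
    open ≤-Reasoning
    L = leafOf forest (here refl)
    open Leaf L
    H′⊑H = ∖-⊑ H neighbour
    neighbour>0 = Adj⇒degree>0 (Adj-sym adjacent)

-- The potential Σₓ min(deg x, 2)

numOneGood-∷ : (e : Edge n) (S : Stream n) → numOneGood (e ∷ S) ≡ 𝟙 (oneGood? (e ∷ S) zero) + numOneGood S
numOneGood-∷ e S = trans (length-filter-∷ good? zero (tabulate Fin.suc)) (cong (𝟙 (good? zero) +_) later)
  where
  good? = oneGood? (e ∷ S)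
  positions = allFin (length S)
  -- Being 1-good at position i + 1 of e ∷ S is definitionally being 1-good at position i of S.
  later : length (filter good? (tabulate Fin.suc)) ≡ numOneGood S
  later = begin
    length (filter good? (tabulate Fin.suc))             ≡⟨ cong (length ∘′ filter good?) (sym (map-tabulate id Fin.suc)) ⟩
    length (filter good? (map Fin.suc positions))        ≡⟨ cong length (filter-map good? Fin.suc positions) ⟩
    length (map Fin.suc (filter (oneGood? S) positions)) ≡⟨ length-map Fin.suc (filter (oneGood? S) positions) ⟩
    numOneGood S                                         ∎
    where open ≡-Reasoning

potential : Stream n → ℕ
potential {n} H = ∑[ x < n ] (degree H x ⊓ 2)

potential≡nonisolated+internal : (H : Stream n) → potential H ≡ nonisolated H + internal H
potential≡nonisolated+internal H =
  trans (sum-cong-≗ (λ x → split (degree H x)))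
        (∑-distrib-+ (λ x → 𝟙 (1 ≤? degree H x)) (λ x → 𝟙 (2 ≤? degree H x)))
  where
  split : ∀ d → d ⊓ 2 ≡ 𝟙 (1 ≤? d) + 𝟙 (2 ≤? d)
  split zero          = refl
  split (suc zero)    = refl
  split (suc (suc d)) = cong (2 +_) (⊓-zeroʳ d)

potential-∷ : (a b : Fin n) (H : Stream n) →
              potential ((a , b) ∷ H) ≤ potential H + (𝟙 (degree H a ≤? 1) + 𝟙 (degree H b ≤? 1))
potential-∷ {n} a b H = begin
  potential ((a , b) ∷ H)                        ≤⟨ ∑-mono-≤ pointwise ⟩
  ∑[ x < n ] (cap x + (atA x + atB x))           ≡⟨ ∑-distrib-+ cap (λ x → atA x + atB x) ⟩
  potential H + ∑[ x < n ] (atA x + atB x)       ≡⟨ cong (potential H +_) (∑-distrib-+ atA atB) ⟩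
  potential H + (sum atA + sum atB)              ≡⟨ cong (potential H +_) (cong₂ _+_ (∑-sift a low) (∑-sift b low)) ⟩
  potential H + (low a + low b)                  ∎
  where
  open ≤-Reasoning
  cap low atA atB : Fin n → ℕ
  cap x = degree H x ⊓ 2
  atA x = 𝟙 (x ≟ a) * low x
  atB x = 𝟙 (x ≟ b) * low x
  low x = 𝟙 (degree H x ≤? 1)
  cap-+ : ∀ c d → c ≤ 1 → (c + d) ⊓ 2 ≤ d ⊓ 2 + c * 𝟙 (d ≤? 1)
  cap-+ zero          d             _        = ≤-reflexive (sym (+-identityʳ _))
  cap-+ (suc zero)    zero          _        = ≤-refl
  cap-+ (suc zero)    (suc zero)    _        = ≤-refl
  cap-+ (suc zero)    (suc (suc d)) _        = s≤s (s≤s z≤n)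
  cap-+ (suc (suc c)) d             (s≤s ())
  pointwise : ∀ x → degree ((a , b) ∷ H) x ⊓ 2 ≤ cap x + (atA x + atB x)
  pointwise x rewrite degree-∷ (a , b) H x =
    ≤-trans (cap-+ _ (degree H x) (𝟙≤1 (incident? x (a , b))))
            (+-monoʳ-≤ (degree H x ⊓ 2) (≤-trans (*-monoˡ-≤ (low x) (𝟙-⊎-≤ (x ≟ a) (x ≟ b)))
                                                 (≤-reflexive (*-distribʳ-+ (low x) (𝟙 (x ≟ a)) (𝟙 (x ≟ b))))))

potential≤length+numOneGood : (S : Stream n) → potential S ≤ length S + numOneGood S
potential≤length+numOneGood {n} []      = ≤-reflexive (sum-replicate-zero n)
potential≤length+numOneGood ((a , b) ∷ S) = begin
  potential ((a , b) ∷ S)                                  ≤⟨ potential-∷ a b S ⟩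
  potential S + (𝟙 (degree S a ≤? 1) + 𝟙 (degree S b ≤? 1)) ≤⟨ +-mono-≤ (potential≤length+numOneGood S)
                                                                       (𝟙+𝟙≤1+𝟙-× (degree S a ≤? 1) (degree S b ≤? 1)) ⟩
  (length S + numOneGood S) + (1 + 𝟙 good?)                ≡⟨ rearrange (length S) (numOneGood S) (𝟙 good?) ⟩
  suc (length S) + (𝟙 good? + numOneGood S)                ≡⟨ cong (suc (length S) +_) (sym (numOneGood-∷ (a , b) S)) ⟩
  length ((a , b) ∷ S) + numOneGood ((a , b) ∷ S)          ∎
  where
  open ≤-Reasoning
  good? = oneGood? ((a , b) ∷ S) zero
  rearrange : ∀ l m g → (l + m) + (1 + g) ≡ suc l + (g + m)
  rearrange = solve-∀

1+internal≤numOneGood : Forest S → e ∈ S → suc (internal S) ≤ numOneGood S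
1+internal≤numOneGood {S = S} forest e∈S = +-cancelˡ-≤ (length S) _ _ (begin
  length S + suc (internal S)  ≡⟨ +-suc (length S) (internal S) ⟩
  suc (length S) + internal S  ≤⟨ +-monoˡ-≤ (internal S) (length<nonisolated forest e∈S) ⟩
  nonisolated S + internal S   ≡⟨ sym (potential≡nonisolated+internal S) ⟩
  potential S                  ≤⟨ potential≤length+numOneGood S ⟩
  length S + numOneGood S      ∎)
  where open ≤-Reasoning

-- The two bounds

isolatedEdge : Connected S → (a , b) ∈ S → degree S a ≤ 1 → degree S b ≤ 1 → ∀ z → Incident z (a , b)
isolatedEdge {S = S} {a = a} {b = b} connected ab∈S a≤1 b≤1 z = along (connected a z) (inj₁ refl)
  where
  end≤1 : Incident x (a , b) → degree S x ≤ 1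
  end≤1 (inj₁ refl) = a≤1
  end≤1 (inj₂ refl) = b≤1
  along : Star (Adj S) x y → Incident x (a , b) → Incident y (a , b)
  along ε            x∈ab = x∈ab
  along (x~w ◅ w⋯y) x∈ab with f , f∈S , f≈xw ← adjacent-edge x~w =
    along w⋯y (subst (Incident _) f≡ab (proj₂ (SameEdge⇒incident f≈xw)))
    where f≡ab = degree≤1⇒unique (end≤1 x∈ab) f∈S ab∈S (proj₁ (SameEdge⇒incident f≈xw)) x∈ab

internalEnds : Stream n → List (Edge n) → List (Fin n)
internalEnds S []            = []
internalEnds S ((a , b) ∷ M) with 2 ≤? degree S a | 2 ≤? degree S b
... | yes _ | _     = a ∷ internalEnds S M
... | no _  | yes _ = b ∷ internalEnds S M
... | no _  | no _  = internalEnds S M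

internalEnds-sound : (S : Stream n) (M : List (Edge n)) →
                     All (λ z → 2 ≤ degree S z × Any (Incident z) M) (internalEnds S M)
internalEnds-sound S []            = []
internalEnds-sound S ((a , b) ∷ M) with 2 ≤? degree S a | 2 ≤? degree S b
... | yes a≥2 | _       = (a≥2 , here (inj₁ refl)) ∷ All.map (map₂ there) (internalEnds-sound S M)
... | no _    | yes b≥2 = (b≥2 , here (inj₂ refl)) ∷ All.map (map₂ there) (internalEnds-sound S M)
... | no _    | no _    = All.map (map₂ there) (internalEnds-sound S M)

internalEnds-avoid : (S : Stream n) {M : List (Edge n)} → All (Disjoint e) M → Incident x e →
                     All (x ≢_) (internalEnds S M)
internalEnds-avoid {e = e} {x = x} S {M} e#M x∈e = All.map avoid (internalEnds-sound S M)
  where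
  avoid : ∀ {z} → 2 ≤ degree S z × Any (Incident z) M → x ≢ z
  avoid (_ , z∈M) refl with e#f , x∈f ← All.lookupAny e#M z∈M = Disjoint⇒¬incident e#f x∈e x∈f

internalEnds-unique : (S : Stream n) {M : List (Edge n)} → AllPairs Disjoint M → Unique (internalEnds S M)
internalEnds-unique S []                                   = []
internalEnds-unique S {(a , b) ∷ M} (ab#M ∷ disjoint) with 2 ≤? degree S a | 2 ≤? degree S b
... | yes _ | _     = internalEnds-avoid S ab#M (inj₁ refl) ∷ internalEnds-unique S disjoint
... | no _  | yes _ = internalEnds-avoid S ab#M (inj₂ refl) ∷ internalEnds-unique S disjoint
... | no _  | no _  = internalEnds-unique S disjoint

length≤1+internalEnds : Connected S → {M : List (Edge n)} → IsMatching S M →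
                        length M ≤ suc (length (internalEnds S M))
length≤1+internalEnds connected {[]} _ = z≤n
length≤1+internalEnds {S = S} connected {(a , b) ∷ M} (ab∈S ∷ M⊆S , ab#M ∷ disjoint)
  with 2 ≤? degree S a | 2 ≤? degree S b
... | yes _  | _      = s≤s (length≤1+internalEnds connected (M⊆S , disjoint))
... | no _   | yes _  = s≤s (length≤1+internalEnds connected (M⊆S , disjoint))
... | no a≱2 | no b≱2 with M | ab#M
...   | []          | _          = s≤s z≤n
...   | (c , _) ∷ _ | ab#cd ∷ _ =
  ⊥-elim (Disjoint⇒¬incident ab#cd c∈ab (inj₁ refl))
  where c∈ab = isolatedEdge connected ab∈S (≤-pred (≰⇒> a≱2)) (≤-pred (≰⇒> b≱2)) c

matching≤1+internal : Connected S → {M : List (Edge n)} → IsMatching S M → length M ≤ suc (internal S)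
matching≤1+internal {S = S} connected {M} matching@(_ , disjoint) =
  ≤-trans (length≤1+internalEnds connected matching)
          (s≤s (length≤count (λ x → 2 ≤? degree S x) (internalEnds-unique S disjoint)
                             (All.map proj₁ (internalEnds-sound S M))))

matching≤numOneGood : Forest S → Connected S → {M : List (Edge n)} → IsMatching S M → length M ≤ numOneGood S
matching≤numOneGood forest connected {[]}    _                  = z≤n
matching≤numOneGood forest connected {_ ∷ _} matching@(e∈S ∷ _ , _) =
  ≤-trans (matching≤1+internal connected matching) (1+internal≤numOneGood forest e∈S)

goodEdges : Stream n → Stream n
goodEdges []      = []
goodEdges (e ∷ S) = if does (oneGood? (e ∷ S) zero) then e ∷ goodEdges S else goodEdges S

goodEdges-⊑ : (S : Stream n) → goodEdges S ⊑ S
goodEdges-⊑ []      = []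
goodEdges-⊑ (e ∷ S) = keep (oneGood? (e ∷ S) zero)
  where
  keep : (good? : Dec (OneGood (e ∷ S) zero)) → (if does good? then e ∷ goodEdges S else goodEdges S) ⊑ e ∷ S
  keep (yes _) = refl ∷ goodEdges-⊑ S
  keep (no  _) = e ∷ʳ goodEdges-⊑ S

length-goodEdges : (S : Stream n) → length (goodEdges S) ≡ numOneGood S
length-goodEdges []      = refl
length-goodEdges (e ∷ S) = trans (keep (oneGood? (e ∷ S) zero)) (sym (numOneGood-∷ e S))
  where
  keep : (good? : Dec (OneGood (e ∷ S) zero)) →
         length (if does good? then e ∷ goodEdges S else goodEdges S) ≡ 𝟙 good? + numOneGood S
  keep (yes _) = cong suc (length-goodEdges S)
  keep (no  _) = length-goodEdges S

degree-goodEdges≤2 : (S : Stream n) (x : Fin n) → degree (goodEdges S) x ≤ 2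
degree-goodEdges≤2 []            x = z≤n
degree-goodEdges≤2 ((a , b) ∷ S) x = keep (oneGood? ((a , b) ∷ S) zero)
  where
  keep : (good? : Dec (OneGood ((a , b) ∷ S) zero)) →
         degree (if does good? then (a , b) ∷ goodEdges S else goodEdges S) x ≤ 2
  keep (no _)           = degree-goodEdges≤2 S x
  keep (yes (a≤1 , b≤1)) = subst (_≤ 2) (sym (degree-∷ (a , b) (goodEdges S) x)) (new (incident? x (a , b)))
    where
    new : (x∈ab? : Dec (Incident x (a , b))) → 𝟙 x∈ab? + degree (goodEdges S) x ≤ 2
    new (no _)            = degree-goodEdges≤2 S x
    new (yes (inj₁ refl)) = s≤s (≤-trans (degree-⊑ (goodEdges-⊑ S) x) a≤1)
    new (yes (inj₂ refl)) = s≤s (≤-trans (degree-⊑ (goodEdges-⊑ S) x) b≤1)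

numOneGood≤2*matching : Forest S → ∀ {k} → (∀ M → IsMatching S M → length M ≤ k) → numOneGood S ≤ 2 * k
numOneGood≤2*matching {S = S} forest {k} maximum =
  let M , matching , length≤ = halfMatching (Forest-⊑ (goodEdges-⊑ S) forest) (degree-goodEdges≤2 S)
  in begin
    numOneGood S         ≡⟨ sym (length-goodEdges S) ⟩
    length (goodEdges S) ≤⟨ length≤ ⟩
    2 * length M         ≤⟨ *-monoʳ-≤ 2 (maximum M (IsMatching-⊑ (goodEdges-⊑ S) matching)) ⟩
    2 * k                ∎
  where open ≤-Reasoning

lemma4 : (n : ℕ) (S : Stream n) (Mstar : ℕ) →
         IsTree n S → IsMaxMatchingSize S Mstar →
         Mstar ≤ numOneGood S × numOneGood S ≤ 2 * Mstar
lemma4 _ _ _ (_ , simple , connected , acyclic) ((M , matching , refl) , maximum) =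
  matching≤numOneGood (simple , acyclic) connected matching , numOneGood≤2*matching (simple , acyclic) maximum
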